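{- Let $k$ be a positive integer and let $X=(V+r,A)$ be an arc-minimal $(r,k)$-flow branching with $|V|\ge 2k-1$. Then $X$ is triple-free, i.e., $X$ does not contain more than two arcs with the same tail and the same head.
   Context: Digraphs are loopless but may have parallel arcs. A rooted digraph $X=(V+r,A)$ has vertex set $V\cup\{r\}$ and root $r$ of in-degree $0$; let $N=|V|+1$. For a vertex set $Y$, $\delta^+(Y)$, $\delta^-(Y)$ denote the sets of arcs leaving and entering $Y$. An $(r,k)$-branching flow in $X$ is a function $\mathbf z:A\to\mathbb Z_{\ge0}$ with $\mathbf z(a)\le N-k$ for all $a\in A$, $\mathbf z(\delta^+(r))-\mathbf z(\delta^-(r))=N-1$, and $\mathbf z(\delta^-(v))-\mathbf z(\delta^+(v))=1$ for all $v\in V$ (where $\mathbf z(F)=\sum_{a\in F}\mathbf z(a)$). $X$ is an $(r,k)$-flow branching if it admits an $(r,k)$-branching flow, and it is arc-minimal if no digraph obtained from $X$ by deleting at least one arc (keeping all vertices) is an $(r,k)$-flow branching. -}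

module Defs where

open import Data.Nat using (ℕ; zero; suc; _+_; _∸_; _≤_; _<_; _*_)
open import Data.Fin using (Fin; _≟_)
import Data.Fin as F
open import Data.List using (List; length; lookup)
open import Data.List.Relation.Binary.Sublist.Propositional using (_⊆_)
open import Data.Product using (_×_; _,_; proj₁; proj₂; Σ; ∃)
open import Relation.Nullary using (¬_)
open import Relation.Nullary.Decidable using (⌊_⌋)
open import Relation.Binary.PropositionalEquality using (_≡_; _≢_)
open import Data.Bool using (Bool; true; false; if_then_else_)

-- Vertex set V + r is Fin (suc n); the root r is F.zero, V = {F.suc i}.
-- So |V| = n and N = |V| + 1 = suc n.
-- A (multi)digraph is a list of arcs (tail , head); repeated entries are
-- parallel arcs.
Arc : ℕ → Set
Arc n = Fin (suc n) × Fin (suc n)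

Arcs : ℕ → Set
Arcs n = List (Arc n)

root : ∀ {n} → Fin (suc n)
root = F.zero

sumFin : (m : ℕ) → (Fin m → ℕ) → ℕ
sumFin zero    f = 0
sumFin (suc m) f = f F.zero + sumFin m (λ i → f (F.suc i))

tailOf : ∀ {n} (A : Arcs n) → Fin (length A) → Fin (suc n)
tailOf A i = proj₁ (lookup A i)

headOf : ∀ {n} (A : Arcs n) → Fin (length A) → Fin (suc n)
headOf A i = proj₂ (lookup A i)

outFlow : ∀ {n} (A : Arcs n) → (Fin (length A) → ℕ) → Fin (suc n) → ℕ
outFlow A z v = sumFin (length A) (λ i → if ⌊ tailOf A i ≟ v ⌋ then z i else 0)

inFlow : ∀ {n} (A : Arcs n) → (Fin (length A) → ℕ) → Fin (suc n) → ℕ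
inFlow A z v = sumFin (length A) (λ i → if ⌊ headOf A i ≟ v ⌋ then z i else 0)

Loopless : ∀ {n} → Arcs n → Set
Loopless A = ∀ i → tailOf A i ≢ headOf A i

RootInDeg0 : ∀ {n} → Arcs n → Set
RootInDeg0 A = ∀ i → headOf A i ≢ root

RootedDigraph : (n : ℕ) → Arcs n → Set
RootedDigraph n A = Loopless A × RootInDeg0 A

-- (r,k)-branching flow, N = suc n.  Conservation equations are written
-- additively over ℕ:  z(δ⁺(r)) = z(δ⁻(r)) + (N-1),  z(δ⁻(v)) = z(δ⁺(v)) + 1.
record BranchingFlow (n k : ℕ) (A : Arcs n) (z : Fin (length A) → ℕ) : Set where
  field
    cap    : ∀ a → z a ≤ suc n ∸ k
    atRoot : outFlow A z root ≡ inFlow A z root + n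
    atV    : ∀ (v : Fin n) → inFlow A z (F.suc v) ≡ outFlow A z (F.suc v) + 1

IsFlowBranching : (n k : ℕ) → Arcs n → Set
IsFlowBranching n k A = ∃ λ (z : Fin (length A) → ℕ) → BranchingFlow n k A z

-- Arc-minimal: no digraph obtained by deleting at least one arc
-- (a sub-multiset B ⊆ A with strictly fewer arcs) is an (r,k)-flow branching.
ArcMinimal : (n k : ℕ) → Arcs n → Set
ArcMinimal n k A =
  IsFlowBranching n k A ×
  (∀ (B : Arcs n) → B ⊆ A → length B < length A → ¬ IsFlowBranching n k B)

multiplicity : ∀ {n} (A : Arcs n) → Fin (suc n) → Fin (suc n) → ℕ
multiplicity A u v =
  sumFin (length A) (λ i → if ⌊ tailOf A i ≟ u ⌋ then (if ⌊ headOf A i ≟ v ⌋ then 1 else 0) else 0)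

TripleFree : ∀ {n} → Arcs n → Set
TripleFree A = ∀ u v → multiplicity A u v ≤ 2

-- Suppose some arc a = uv has at least three parallel copies and let S be the set of
-- vertices reachable from v. In an arc-minimal flow branching every branching flow is
-- positive on every arc, since an arc carrying no flow could be deleted. Hence there
-- is no cycle: subtracting the indicator of a simple cycle gives a branching flow of
-- smaller total value which is again positive, and this cannot go on forever. So
-- u ∉ S, and as S is closed under out-arcs and misses the root, the flow entering S
-- equals |S| ≤ |V|. The copies of uv all enter S, so together they carry at most
-- |V| ≤ 2(N - k). That total can be redistributed greedily among the copies within the
-- capacity N - k, leaving one copy without flow, which contradicts arc-minimality.
module Submission where

open import Defs

open import Data.Bool using (Bool; true; false; if_then_else_; _∧_; not)
open import Data.Empty using (⊥; ⊥-elim)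
open import Data.Fin using (Fin; _≟_)
import Data.Fin as F
open import Data.Fin.Properties using (any?)
open import Data.List using (List; []; _∷_; length; lookup; removeAt)
open import Data.List.Properties using (length-removeAt′)
open import Data.List.Membership.Propositional using (_∈_)
open import Data.List.Membership.DecPropositional using () renaming (_∈?_ to ∈?)
open import Data.List.Relation.Binary.Sublist.Propositional using (_⊆_; ⊆-refl; _∷ʳ_; _∷_)
open import Data.List.Relation.Unary.All as All using (All; []; _∷_)
open import Data.List.Relation.Unary.All.Properties using (¬Any⇒All¬; All¬⇒¬Any)
open import Data.List.Relation.Unary.AllPairs using ([]; _∷_)
open import Data.List.Relation.Unary.Any using (here; there)
open import Data.List.Relation.Unary.Unique.Propositional using (Unique)
open import Data.Nat using (ℕ; zero; suc; _+_; _*_; _∸_; _≤_; _<_; _⊓_; _⊔_; z≤n; s≤s; _≤?_)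
open import Data.Nat.Induction using (<-wellFounded)
open import Data.Nat.Properties hiding (_≟_)
open import Algebra.Properties.CommutativeSemigroup +-commutativeSemigroup
  using (interchange; xy∙z≈xz∙y)
open import Data.Product using (_×_; _,_; proj₁; proj₂; Σ; ∃)
open import Data.Sum using (_⊎_; inj₁; inj₂)
open import Function using (_∘_)
open import Induction.WellFounded using (Acc; acc)
open import Relation.Binary.PropositionalEquality
open import Relation.Nullary using (¬_; Dec; yes; no; does; _×-dec_)
open import Relation.Nullary.Decidable using (⌊_⌋)

sumFin-cong : ∀ m {f g : Fin m → ℕ} → (∀ i → f i ≡ g i) → sumFin m f ≡ sumFin m g
sumFin-cong zero    f≗g = refl
sumFin-cong (suc m) f≗g = cong₂ _+_ (f≗g F.zero) (sumFin-cong m (f≗g ∘ F.suc))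

sumFin-zero : ∀ m {f : Fin m → ℕ} → (∀ i → f i ≡ 0) → sumFin m f ≡ 0
sumFin-zero zero    f≗0 = refl
sumFin-zero (suc m) f≗0 rewrite f≗0 F.zero = sumFin-zero m (f≗0 ∘ F.suc)

sumFin-distrib-+ : ∀ m (f g : Fin m → ℕ) →
  sumFin m (λ i → f i + g i) ≡ sumFin m f + sumFin m g
sumFin-distrib-+ zero    f g = refl
sumFin-distrib-+ (suc m) f g =
  trans (cong (f F.zero + g F.zero +_) (sumFin-distrib-+ m (f ∘ F.suc) (g ∘ F.suc)))
        (interchange (f F.zero) (g F.zero) _ _)

sumFin-mono-≤ : ∀ m {f g : Fin m → ℕ} → (∀ i → f i ≤ g i) → sumFin m f ≤ sumFin m g
sumFin-mono-≤ zero    f≤g = z≤n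
sumFin-mono-≤ (suc m) f≤g = +-mono-≤ (f≤g F.zero) (sumFin-mono-≤ m (f≤g ∘ F.suc))

sumFin-≤-* : ∀ m {f : Fin m → ℕ} {c} → (∀ i → f i ≤ c) → sumFin m f ≤ m * c
sumFin-≤-* zero    f≤c = z≤n
sumFin-≤-* (suc m) f≤c = +-mono-≤ (f≤c F.zero) (sumFin-≤-* m (f≤c ∘ F.suc))

term≤sumFin : ∀ m (f : Fin m → ℕ) i → f i ≤ sumFin m f
term≤sumFin (suc m) f F.zero    = m≤m+n _ _
term≤sumFin (suc m) f (F.suc i) = ≤-trans (term≤sumFin m (f ∘ F.suc) i) (m≤n+m _ _)

sumFin-positive : ∀ m (f : Fin m → ℕ) → 1 ≤ sumFin m f → ∃ λ i → 1 ≤ f i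
sumFin-positive (suc m) f 1≤Σ with f F.zero in f₀≡
... | suc _ = F.zero , subst (1 ≤_) (sym f₀≡) (s≤s z≤n)
... | zero  with sumFin-positive m (f ∘ F.suc) 1≤Σ
...   | i , 1≤fi = F.suc i , 1≤fi

sumFin-comm : ∀ a b (g : Fin a → Fin b → ℕ) →
  sumFin a (λ p → sumFin b (g p)) ≡ sumFin b (λ q → sumFin a (λ p → g p q))
sumFin-comm zero    b g = sym (sumFin-zero b (λ _ → refl))
sumFin-comm (suc a) b g rewrite sumFin-comm a b (g ∘ F.suc) =
  sym (sumFin-distrib-+ b (g F.zero) (λ q → sumFin a (λ p → g (F.suc p) q)))

sumFin-if : ∀ m b (f : Fin m → ℕ) →
  sumFin m (λ i → if b then f i else 0) ≡ (if b then sumFin m f else 0)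
sumFin-if m true  f = refl
sumFin-if m false f = sumFin-zero m (λ _ → refl)

≟-refl : ∀ {k} (x : Fin k) → ⌊ x ≟ x ⌋ ≡ true
≟-refl x with x ≟ x
... | yes _   = refl
... | no x≢x = ⊥-elim (x≢x refl)

sumFin-δ : ∀ k (x : Fin k) (f : Fin k → ℕ) →
  sumFin k (λ q → if ⌊ x ≟ q ⌋ then f q else 0) ≡ f x
sumFin-δ (suc k) F.zero f = trans (cong (f F.zero +_) (sumFin-zero k (λ _ → refl))) (+-identityʳ _)
sumFin-δ (suc k) (F.suc x) f = trans (sumFin-cong k suc-≟) (sumFin-δ k x (f ∘ F.suc))
  where
  suc-≟ : ∀ q → (if ⌊ F.suc x ≟ F.suc q ⌋ then f (F.suc q) else 0) ≡ (if ⌊ x ≟ q ⌋ then f (F.suc q) else 0)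
  suc-≟ q with x ≟ q
  ... | yes _ = refl
  ... | no  _ = refl

if-swap : ∀ a b (x : ℕ) →
  (if a then (if b then x else 0) else 0) ≡ (if b then (if a then x else 0) else 0)
if-swap true  b x = refl
if-swap false true  x = refl
if-swap false false x = refl

if-zero : ∀ b → (if b then 0 else 0) ≡ 0
if-zero true  = refl
if-zero false = refl

sumWhere : ∀ {m} → (Fin m → Bool) → (Fin m → ℕ) → ℕ
sumWhere {m} b w = sumFin m (λ i → if b i then w i else 0)

sumWhere-zero : ∀ {m} (b : Fin m → Bool) → sumWhere b (λ _ → 0) ≡ 0
sumWhere-zero {m} b = sumFin-zero m (if-zero ∘ b)

count : ∀ {m} → (Fin m → Bool) → ℕ
count b = sumWhere b (λ _ → 1)

count-positive : ∀ {m} (b : Fin m → Bool) → 1 ≤ count b → ∃ λ i → b i ≡ true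
count-positive {m} b 1≤count with sumFin-positive m _ 1≤count
... | i , 1≤bi with b i in bi
...   | true = i , bi

sumWhere-mono-≤ : ∀ {m} {b b′ : Fin m → Bool} (w : Fin m → ℕ) → (∀ i → b i ≡ true → b′ i ≡ true) →
  sumWhere b w ≤ sumWhere b′ w
sumWhere-mono-≤ {m} {b} {b′} w b⇒b′ = sumFin-mono-≤ m pointwise
  where
  pointwise : ∀ i → (if b i then w i else 0) ≤ (if b′ i then w i else 0)
  pointwise i with b i in bi
  ... | false = z≤n
  ... | true rewrite b⇒b′ i bi = ≤-refl

sumWhere-∸ : ∀ {m} (b : Fin m → Bool) {w c : Fin m → ℕ} → (∀ i → c i ≤ w i) →
  sumWhere b w ≡ sumWhere b (λ i → w i ∸ c i) + sumWhere b c
sumWhere-∸ {m} b {w} {c} c≤w = trans (sumFin-cong m pointwise) (sumFin-distrib-+ m _ _)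
  where
  pointwise : ∀ i → (if b i then w i else 0) ≡ (if b i then w i ∸ c i else 0) + (if b i then c i else 0)
  pointwise i with b i
  ... | true  = sym (m∸n+n≡m (c≤w i))
  ... | false = refl

sumWhere-split : ∀ {m} (P b : Fin m → Bool) (w : Fin m → ℕ) →
  sumWhere b w ≡ sumWhere (λ i → P i ∧ b i) w + sumWhere (λ i → not (P i) ∧ b i) w
sumWhere-split {m} P b w = trans (sumFin-cong m pointwise) (sumFin-distrib-+ m _ _)
  where
  pointwise : ∀ i → (if b i then w i else 0) ≡
    (if P i ∧ b i then w i else 0) + (if not (P i) ∧ b i then w i else 0)
  pointwise i with P i
  ... | true  = sym (+-identityʳ _)
  ... | false = refl

sumWhere-endpoint-redistribute : ∀ {m k} (e : Fin m → Fin k) (x : Fin k) (P : Fin m → Bool) →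
  (∀ i → P i ≡ true → e i ≡ x) → (w w′ : Fin m → ℕ) → (∀ i → P i ≡ false → w i ≡ w′ i) →
  sumWhere P w ≡ sumWhere P w′ → ∀ q →
  sumWhere (λ i → ⌊ e i ≟ q ⌋) w ≡ sumWhere (λ i → ⌊ e i ≟ q ⌋) w′
sumWhere-endpoint-redistribute {m} e x P P⇒x w w′ w≗w′ ΣP≡ q = begin
  sumWhere b w
    ≡⟨ sumWhere-split P b w ⟩
  inner w + rest w
    ≡⟨ cong₂ _+_ (inside w) (sumFin-cong m outside) ⟩
  (if ⌊ x ≟ q ⌋ then sumWhere P w else 0) + rest w′
    ≡⟨ cong (λ s → (if ⌊ x ≟ q ⌋ then s else 0) + rest w′) ΣP≡ ⟩
  (if ⌊ x ≟ q ⌋ then sumWhere P w′ else 0) + rest w′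
    ≡⟨ cong (_+ rest w′) (sym (inside w′)) ⟩
  inner w′ + rest w′
    ≡⟨ sym (sumWhere-split P b w′) ⟩
  sumWhere b w′ ∎
  where
  open ≡-Reasoning
  b : Fin m → Bool
  b i = ⌊ e i ≟ q ⌋
  inner rest : (Fin m → ℕ) → ℕ
  inner = sumWhere (λ i → P i ∧ b i)
  rest  = sumWhere (λ i → not (P i) ∧ b i)
  inside : ∀ v → inner v ≡ (if ⌊ x ≟ q ⌋ then sumWhere P v else 0)
  inside v = trans (sumFin-cong m pointwise) (sumFin-if m ⌊ x ≟ q ⌋ _)
    where
    pointwise : ∀ i → (if P i ∧ b i then v i else 0) ≡ (if ⌊ x ≟ q ⌋ then (if P i then v i else 0) else 0)
    pointwise i with P i in Pi
    ... | true rewrite P⇒x i Pi = sym (if-swap ⌊ x ≟ q ⌋ true (v i))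
    ... | false = sym (if-swap ⌊ x ≟ q ⌋ false (v i))
  outside : ∀ i → (if not (P i) ∧ b i then w i else 0) ≡ (if not (P i) ∧ b i then w′ i else 0)
  outside i with P i in Pi
  ... | true  = refl
  ... | false rewrite w≗w′ i Pi = refl

BranchingFlow-resp-flows : ∀ {n k} {A A′ : Arcs n} {z : Fin (length A) → ℕ} {z′ : Fin (length A′) → ℕ} →
  (∀ a → z′ a ≤ suc n ∸ k) → (∀ q → outFlow A′ z′ q ≡ outFlow A z q) →
  (∀ q → inFlow A′ z′ q ≡ inFlow A z q) → BranchingFlow n k A z → BranchingFlow n k A′ z′
BranchingFlow-resp-flows {n} cap′ out≡ in≡ bf = record
  { cap    = cap′
  ; atRoot = trans (out≡ root) (trans (atRoot bf) (cong (_+ n) (sym (in≡ root))))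
  ; atV    = λ v → trans (in≡ (F.suc v)) (trans (atV bf v) (cong (_+ 1) (sym (out≡ (F.suc v)))))
  }
  where open BranchingFlow

Circulation : ∀ {n} (A : Arcs n) → (Fin (length A) → ℕ) → Set
Circulation A c = ∀ q → outFlow A c q ≡ inFlow A c q

BranchingFlow-∸-circulation : ∀ {n k} {A : Arcs n} {z c : Fin (length A) → ℕ} →
  (∀ i → c i ≤ z i) → Circulation A c → BranchingFlow n k A z →
  BranchingFlow n k A (λ i → z i ∸ c i)
BranchingFlow-∸-circulation {n} {A = A} {z} {c} c≤z circ bf = record
  { cap    = λ i → ≤-trans (m∸n≤m (z i) (c i)) (cap bf i)
  ; atRoot = balance (outSplit root) (inSplit root) (circ root) (atRoot bf)
  ; atV    = λ v → balance (inSplit (F.suc v)) (outSplit (F.suc v)) (sym (circ (F.suc v))) (atV bf v)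
  }
  where
  open BranchingFlow
  outSplit : ∀ q → outFlow A z q ≡ outFlow A (λ i → z i ∸ c i) q + outFlow A c q
  outSplit q = sumWhere-∸ (λ i → ⌊ tailOf A i ≟ q ⌋) c≤z
  inSplit : ∀ q → inFlow A z q ≡ inFlow A (λ i → z i ∸ c i) q + inFlow A c q
  inSplit q = sumWhere-∸ (λ i → ⌊ headOf A i ≟ q ⌋) c≤z
  balance : ∀ {x x′ cx y y′ cy d} → x ≡ x′ + cx → y ≡ y′ + cy → cx ≡ cy → x ≡ y + d → x′ ≡ y′ + d
  balance {x} {x′} {cx} {y} {y′} {cy} {d} refl refl refl x≡y+d =
    +-cancelʳ-≡ cx x′ (y′ + d) (trans x≡y+d (xy∙z≈xz∙y y′ cx d))

module _ {X : Set} where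

  punchIn-removeAt : (xs : List X) (i : Fin (length xs)) → Fin (length (removeAt xs i)) → Fin (length xs)
  punchIn-removeAt (x ∷ xs) F.zero    j         = F.suc j
  punchIn-removeAt (x ∷ xs) (F.suc i) F.zero    = F.zero
  punchIn-removeAt (x ∷ xs) (F.suc i) (F.suc j) = F.suc (punchIn-removeAt xs i j)

  lookup-removeAt : (xs : List X) (i : Fin (length xs)) (j : Fin (length (removeAt xs i))) →
    lookup (removeAt xs i) j ≡ lookup xs (punchIn-removeAt xs i j)
  lookup-removeAt (x ∷ xs) F.zero    j         = refl
  lookup-removeAt (x ∷ xs) (F.suc i) F.zero    = refl
  lookup-removeAt (x ∷ xs) (F.suc i) (F.suc j) = lookup-removeAt xs i j

  sumFin-removeAt : (xs : List X) (i : Fin (length xs)) (g : Fin (length xs) → ℕ) → g i ≡ 0 →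
    sumFin (length (removeAt xs i)) (g ∘ punchIn-removeAt xs i) ≡ sumFin (length xs) g
  sumFin-removeAt (x ∷ xs) F.zero    g gi≡0 rewrite gi≡0 = refl
  sumFin-removeAt (x ∷ xs) (F.suc i) g gi≡0 = cong (g F.zero +_) (sumFin-removeAt xs i (g ∘ F.suc) gi≡0)

  removeAt-⊆ : (xs : List X) (i : Fin (length xs)) → removeAt xs i ⊆ xs
  removeAt-⊆ (x ∷ xs) F.zero    = x ∷ʳ ⊆-refl
  removeAt-⊆ (x ∷ xs) (F.suc i) = refl ∷ removeAt-⊆ xs i

IsFlowBranching-removeAt : ∀ {n k} (A : Arcs n) {z} → BranchingFlow n k A z →
  (i : Fin (length A)) → z i ≡ 0 → IsFlowBranching n k (removeAt A i)
IsFlowBranching-removeAt A {z} bf i zi≡0 =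
  z ∘ punchIn-removeAt A i ,
  BranchingFlow-resp-flows (BranchingFlow.cap bf ∘ punchIn-removeAt A i)
    (endpointFlow proj₁) (endpointFlow proj₂) bf
  where
  endpointFlow : ∀ (e : Arc _ → Fin _) q →
    sumWhere (λ j → ⌊ e (lookup (removeAt A i) j) ≟ q ⌋) (z ∘ punchIn-removeAt A i) ≡
    sumWhere (λ j → ⌊ e (lookup A j) ≟ q ⌋) z
  endpointFlow e q =
    trans (sumFin-cong _ (λ j → cong (λ a → if ⌊ e a ≟ q ⌋ then z (punchIn-removeAt A i j) else 0)
                                     (lookup-removeAt A i j)))
          (sumFin-removeAt A i _ zeroTerm)
    where
    zeroTerm : (if ⌊ e (lookup A i) ≟ q ⌋ then z i else 0) ≡ 0
    zeroTerm with ⌊ e (lookup A i) ≟ q ⌋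
    ... | true  = zi≡0
    ... | false = refl

ArcMinimal⇒positive : ∀ {n k} {A : Arcs n} → ArcMinimal n k A →
  ∀ {z} → BranchingFlow n k A z → ∀ i → 1 ≤ z i
ArcMinimal⇒positive {A = A} (_ , minimal) {z} bf i with z i in zi≡
... | suc _ = s≤s z≤n
... | zero  = ⊥-elim (minimal (removeAt A i) (removeAt-⊆ A i)
                        (≤-reflexive (sym (length-removeAt′ A i)))
                        (IsFlowBranching-removeAt A bf i zi≡))

-- Subtracting c keeps a branching flow and lowers its total, so positivity forces an
-- infinite descent.
no-branchingFlow-above-circulation : ∀ {n k} {A : Arcs n} {c : Fin (length A) → ℕ} →
  (∀ {z} → BranchingFlow n k A z → ∀ i → 1 ≤ z i) → Circulation A c → (∀ i → c i ≤ 1) →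
  ∀ a → 1 ≤ c a → ∀ z → ¬ BranchingFlow n k A z
no-branchingFlow-above-circulation {n} {k} {A} {c} positive circ c≤1 a 1≤ca z =
  descend z (<-wellFounded (sumFin (length A) z))
  where
  m = length A
  descend : ∀ z → Acc _<_ (sumFin m z) → ¬ BranchingFlow n k A z
  descend z (acc smaller) bf = descend z′ (smaller total-decreases) (BranchingFlow-∸-circulation c≤z circ bf)
    where
    c≤z : ∀ i → c i ≤ z i
    c≤z i = ≤-trans (c≤1 i) (positive bf i)
    z′ : Fin m → ℕ
    z′ i = z i ∸ c i
    total-decreases : sumFin m z′ < sumFin m z
    total-decreases = begin-strict
      sumFin m z′                   <⟨ m<m+n _ (≤-trans 1≤ca (term≤sumFin m c a)) ⟩
      sumFin m z′ + sumFin m c      ≡⟨ sym (sumFin-distrib-+ m z′ c) ⟩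
      sumFin m (λ i → z′ i + c i)   ≡⟨ sumFin-cong m (λ i → m∸n+n≡m (c≤z i)) ⟩
      sumFin m z                    ∎
      where open ≤-Reasoning

occurrences : ∀ {k} → List (Fin k) → Fin k → ℕ
occurrences []       q = 0
occurrences (i ∷ is) q = (if ⌊ i ≟ q ⌋ then 1 else 0) + occurrences is q

occurrences-head : ∀ {k} (i : Fin k) is → 1 ≤ occurrences (i ∷ is) i
occurrences-head i is rewrite ≟-refl i = s≤s z≤n

occurrences-∉ : ∀ {k} {i : Fin k} {is} → All (i ≢_) is → occurrences is i ≡ 0
occurrences-∉ []                 = refl
occurrences-∉ {i = i} {j ∷ is} (i≢j ∷ ps) with j ≟ i
... | yes j≡i = ⊥-elim (i≢j (sym j≡i))
... | no  _   = occurrences-∉ ps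

occurrences-unique : ∀ {k} {is : List (Fin k)} → Unique is → ∀ q → occurrences is q ≤ 1
occurrences-unique []                    q = z≤n
occurrences-unique {is = i ∷ is} (i∉ ∷ u) q with i ≟ q
... | yes refl rewrite occurrences-∉ i∉ = ≤-refl
... | no  _    = occurrences-unique u q

sumFin-occurrences : ∀ k (is : List (Fin k)) → sumFin k (occurrences is) ≡ length is
sumFin-occurrences k []       = sumFin-zero k (λ _ → refl)
sumFin-occurrences k (i ∷ is) =
  trans (sumFin-distrib-+ k _ (occurrences is))
        (cong₂ _+_ (sumFin-δ k i (λ _ → 1)) (sumFin-occurrences k is))

Unique⇒length≤ : ∀ {k} {is : List (Fin k)} → Unique is → length is ≤ k
Unique⇒length≤ {k} {is} u =
  subst (_≤ k) (sumFin-occurrences k is)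
        (subst (sumFin k (occurrences is) ≤_) (*-identityʳ k) (sumFin-≤-* k (occurrences-unique u)))

sumWhere-occurrences-∷ : ∀ {m} (b : Fin m → Bool) i is →
  sumWhere b (occurrences (i ∷ is)) ≡ (if b i then 1 else 0) + sumWhere b (occurrences is)
sumWhere-occurrences-∷ {m} b i is =
  trans (sumFin-cong m pointwise)
        (trans (sumFin-distrib-+ m _ _) (cong (_+ _) (sumFin-δ m i (λ j → if b j then 1 else 0))))
  where
  pointwise : ∀ j → (if b j then occurrences (i ∷ is) j else 0) ≡
    (if ⌊ i ≟ j ⌋ then (if b j then 1 else 0) else 0) + (if b j then occurrences is j else 0)
  pointwise j with b j
  ... | true  = refl
  ... | false = sym (trans (+-identityʳ _) (if-zero ⌊ i ≟ j ⌋))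

module _ {n : ℕ} (A : Arcs n) where

  private
    V = Fin (suc n)
    m = length A
    t = tailOf A
    h = headOf A

  data Walk : V → V → Set where
    nil  : ∀ {x} → Walk x x
    cons : ∀ {x y} (i : Fin m) → t i ≡ x → Walk (h i) y → Walk x y

  arcs : ∀ {x y} → Walk x y → List (Fin m)
  arcs nil          = []
  arcs (cons i _ w) = i ∷ arcs w

  vertices : ∀ {x y} → Walk x y → List V
  vertices {x} nil          = x ∷ []
  vertices {x} (cons i _ w) = x ∷ vertices w

  SimpleWalk : V → V → Set
  SimpleWalk x y = Σ (Walk x y) (Unique ∘ vertices)

  _++ʷ_ : ∀ {x y z} → Walk x y → Walk y z → Walk x z
  nil          ++ʷ w′ = w′
  cons i e w   ++ʷ w′ = cons i e (w ++ʷ w′)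

  end∈vertices : ∀ {x y} (w : Walk x y) → y ∈ vertices w
  end∈vertices nil          = here refl
  end∈vertices (cons i _ w) = there (end∈vertices w)

  tail∈vertices : ∀ {x y} (w : Walk x y) {j} → j ∈ arcs w → t j ∈ vertices w
  tail∈vertices (cons i e w) (here refl) = here e
  tail∈vertices (cons i e w) (there j∈) = there (tail∈vertices w j∈)

  length-vertices : ∀ {x y} (w : Walk x y) → length (vertices w) ≡ suc (length (arcs w))
  length-vertices nil          = refl
  length-vertices (cons i _ w) = cong suc (length-vertices w)

  simple⇒length≤ : ∀ {x y} ((w , u) : SimpleWalk x y) → length (arcs w) ≤ n
  simple⇒length≤ (w , u) = ≤-pred (subst (_≤ suc n) (length-vertices w) (Unique⇒length≤ u))

  simple⇒unique-arcs : ∀ {x y} ((w , u) : SimpleWalk x y) → Unique (arcs w)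
  simple⇒unique-arcs (nil , _) = []
  simple⇒unique-arcs (cons i e w , x∉w ∷ u) =
    All.tabulate (λ { j∈ refl → All¬⇒¬Any x∉w (subst (_∈ vertices w) e (tail∈vertices w j∈)) })
    ∷ simple⇒unique-arcs (w , u)

  simple⇒tail≢end : ∀ {x y} ((w , u) : SimpleWalk x y) → ∀ {j} → j ∈ arcs w → t j ≢ y
  simple⇒tail≢end (cons i e w , x∉w ∷ u) (here refl) = All.lookup x∉w (end∈vertices w) ∘ trans (sym e)
  simple⇒tail≢end (cons i e w , _ ∷ u)   (there j∈) = simple⇒tail≢end (w , u) j∈

  suffix : ∀ {x y q} ((w , u) : SimpleWalk x y) → q ∈ vertices w → SimpleWalk q y
  suffix (nil , u)        (here refl) = nil , u
  suffix (cons i e w , u) (here refl) = cons i e w , u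
  suffix (cons i e w , _ ∷ u) (there q∈) = suffix (w , u) q∈

  shortcut : ∀ {x y} → Walk x y → SimpleWalk x y
  shortcut nil = nil , [] ∷ []
  shortcut {x} (cons i e w) with shortcut w
  ... | (w′ , u) with ∈? _≟_ x (vertices w′)
  ...   | yes x∈ = suffix (w′ , u) x∈
  ...   | no  x∉ = cons i e w′ , ¬Any⇒All¬ _ x∉ ∷ u

  trivial-or-enters-end : ∀ {x y} → Walk x y → x ≡ y ⊎ ∃ λ i → h i ≡ y
  trivial-or-enters-end nil = inj₁ refl
  trivial-or-enters-end (cons i _ w) with trivial-or-enters-end w
  ... | inj₁ refl = inj₂ (i , refl)
  ... | inj₂ last = inj₂ last

  boundedWalk? : ∀ j x y → Dec (Σ (Walk x y) λ w → length (arcs w) ≤ j)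
  boundedWalk? j x y with x ≟ y
  ... | yes refl = yes (nil , z≤n)
  boundedWalk? zero x y | no x≢y = no λ { (nil , _) → x≢y refl ; (cons _ _ _ , ()) }
  boundedWalk? (suc j) x y | no x≢y with any? (λ i → (t i ≟ x) ×-dec boundedWalk? j (h i) y)
  ... | yes (i , e , w , ℓ≤j) = yes (cons i e w , s≤s ℓ≤j)
  ... | no ¬step = no λ { (nil , _) → x≢y refl ; (cons i e w , s≤s ℓ≤j) → ¬step (i , e , w , ℓ≤j) }

  reachable : V → V → Bool
  reachable x y = does (boundedWalk? n x y)

  reachable-sound : ∀ {x y} → reachable x y ≡ true → Walk x y
  reachable-sound {x} {y} r with boundedWalk? n x y
  ... | yes (w , _) = w

  reachable-complete : ∀ {x y} → Walk x y → reachable x y ≡ true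
  reachable-complete {x} {y} w with boundedWalk? n x y
  ... | yes _  = refl
  ... | no ¬w = ⊥-elim (¬w (proj₁ (shortcut w) , simple⇒length≤ (shortcut w)))

  reachable-closed : ∀ {x} i → reachable x (t i) ≡ true → reachable x (h i) ≡ true
  reachable-closed {x} i r = reachable-complete (reachable-sound {x} r ++ʷ cons i refl nil)

  walk-balance : ∀ {x y} (w : Walk x y) q →
    outFlow A (occurrences (arcs w)) q + (if ⌊ y ≟ q ⌋ then 1 else 0) ≡
    inFlow A (occurrences (arcs w)) q + (if ⌊ x ≟ q ⌋ then 1 else 0)
  walk-balance nil q =
    cong (_+ _) (trans (sumWhere-zero (λ i → ⌊ t i ≟ q ⌋)) (sym (sumWhere-zero (λ i → ⌊ h i ≟ q ⌋))))
  walk-balance {y = y} (cons i refl w) q = begin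
    outFlow A (occurrences (i ∷ L)) q + δ y
      ≡⟨ cong (_+ δ y) (sumWhere-occurrences-∷ (λ j → ⌊ t j ≟ q ⌋) i L) ⟩
    δ (t i) + outFlow A (occurrences L) q + δ y
      ≡⟨ +-assoc (δ (t i)) _ _ ⟩
    δ (t i) + (outFlow A (occurrences L) q + δ y)
      ≡⟨ cong (δ (t i) +_) (walk-balance w q) ⟩
    δ (t i) + (inFlow A (occurrences L) q + δ (h i))
      ≡⟨ +-comm (δ (t i)) _ ⟩
    inFlow A (occurrences L) q + δ (h i) + δ (t i)
      ≡⟨ cong (_+ δ (t i)) (+-comm _ (δ (h i))) ⟩
    δ (h i) + inFlow A (occurrences L) q + δ (t i)
      ≡⟨ cong (_+ δ (t i)) (sym (sumWhere-occurrences-∷ (λ j → ⌊ h j ≟ q ⌋) i L)) ⟩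
    inFlow A (occurrences (i ∷ L)) q + δ (t i) ∎
    where
    open ≡-Reasoning
    L = arcs w
    δ : V → ℕ
    δ x = if ⌊ x ≟ q ⌋ then 1 else 0

  closedWalk-circulation : ∀ {x} (w : Walk x x) → Circulation A (occurrences (arcs w))
  closedWalk-circulation w q = +-cancelʳ-≡ _ _ _ (walk-balance w q)

ArcMinimal⇒acyclic : ∀ {n k} {A : Arcs n} → ArcMinimal n k A →
  ∀ i → Walk A (headOf A i) (tailOf A i) → ⊥
ArcMinimal⇒acyclic {A = A} minimal i back =
  no-branchingFlow-above-circulation (ArcMinimal⇒positive minimal)
    (closedWalk-circulation A cycle) (occurrences-unique unique-arcs)
    i (occurrences-head i (arcs A (proj₁ simple)))
    _ (proj₂ (proj₁ minimal))
  where
  simple = shortcut A back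
  cycle : Walk A (tailOf A i) (tailOf A i)
  cycle = cons i refl (proj₁ simple)
  unique-arcs : Unique (arcs A cycle)
  unique-arcs = All.tabulate (λ j∈ i≡j → simple⇒tail≢end A simple j∈ (cong (tailOf A) (sym i≡j)))
                ∷ simple⇒unique-arcs A simple

sumFin-sumWhere-endpoint : ∀ {m k} (S : Fin k → Bool) (e : Fin m → Fin k) (z : Fin m → ℕ) →
  sumFin k (λ q → if S q then sumWhere (λ i → ⌊ e i ≟ q ⌋) z else 0) ≡ sumWhere (S ∘ e) z
sumFin-sumWhere-endpoint {m} {k} S e z = begin
  sumFin k (λ q → if S q then sumWhere (λ i → ⌊ e i ≟ q ⌋) z else 0)
    ≡⟨ sumFin-cong k (λ q → sym (sumFin-if m (S q) (λ i → if ⌊ e i ≟ q ⌋ then z i else 0))) ⟩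
  sumFin k (λ q → sumFin m (λ i → if S q then (if ⌊ e i ≟ q ⌋ then z i else 0) else 0))
    ≡⟨ sumFin-comm k m (λ q i → if S q then (if ⌊ e i ≟ q ⌋ then z i else 0) else 0) ⟩
  sumFin m (λ i → sumFin k (λ q → if S q then (if ⌊ e i ≟ q ⌋ then z i else 0) else 0))
    ≡⟨ sumFin-cong m (λ i → sumFin-cong k (λ q → if-swap (S q) ⌊ e i ≟ q ⌋ (z i))) ⟩
  sumFin m (λ i → sumFin k (λ q → if ⌊ e i ≟ q ⌋ then (if S q then z i else 0) else 0))
    ≡⟨ sumFin-cong m (λ i → sumFin-δ k (e i) (λ q → if S q then z i else 0)) ⟩
  sumWhere (S ∘ e) z ∎
  where open ≡-Reasoning

flowInto : ∀ {n} (A : Arcs n) → (Fin (length A) → ℕ) → (Fin (suc n) → Bool) → ℕ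
flowInto A z S = sumWhere (λ i → S (headOf A i) ∧ not (S (tailOf A i))) z

-- Sum conservation over S: no flow leaves S, and every vertex of S absorbs one unit.
flowInto-closed≡count : ∀ {n k} {A : Arcs n} {z} → BranchingFlow n k A z →
  (S : Fin (suc n) → Bool) → S root ≡ false →
  (∀ i → S (tailOf A i) ≡ true → S (headOf A i) ≡ true) →
  flowInto A z S ≡ count S
flowInto-closed≡count {n} {A = A} {z} bf S S-root closed =
  +-cancelˡ-≡ (endsIn (tailOf A)) _ _ (trans (sym head≡tail+entering) head≡tail+count)
  where
  m = length A
  endsIn : (Fin m → Fin (suc n)) → ℕ
  endsIn e = sumWhere (S ∘ e) z
  conservation : ∀ q → (if S q then inFlow A z q else 0) ≡
    (if S q then outFlow A z q else 0) + (if S q then 1 else 0)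
  conservation F.zero rewrite S-root = refl
  conservation (F.suc v) with S (F.suc v)
  ... | true  = BranchingFlow.atV bf v
  ... | false = refl
  head≡tail+count : endsIn (headOf A) ≡ endsIn (tailOf A) + count S
  head≡tail+count =
    trans (sym (sumFin-sumWhere-endpoint S (headOf A) z))
          (trans (sumFin-cong (suc n) conservation)
                 (trans (sumFin-distrib-+ (suc n) (λ q → if S q then outFlow A z q else 0)
                                              (λ q → if S q then 1 else 0))
                        (cong (_+ count S) (sumFin-sumWhere-endpoint S (tailOf A) z))))
  head≡tail+entering : endsIn (headOf A) ≡ endsIn (tailOf A) + flowInto A z S
  head≡tail+entering = trans (sumFin-cong m pointwise) (sumFin-distrib-+ m _ _)
    where
    pointwise : ∀ i → (if S (headOf A i) then z i else 0) ≡
      (if S (tailOf A i) then z i else 0) + (if S (headOf A i) ∧ not (S (tailOf A i)) then z i else 0)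
    pointwise i with S (tailOf A i) in St
    ... | true rewrite closed i St = sym (+-identityʳ _)
    ... | false with S (headOf A i)
    ...   | true  = refl
    ...   | false = refl

count-without-root≤ : ∀ n (S : Fin (suc n) → Bool) → S root ≡ false → count S ≤ n
count-without-root≤ n S S-root rewrite S-root =
  subst (count (S ∘ F.suc) ≤_) (*-identityʳ n) (sumFin-≤-* n (indicator≤1 ∘ S ∘ F.suc))
  where
  indicator≤1 : ∀ b → (if b then 1 else 0) ≤ 1
  indicator≤1 true  = ≤-refl
  indicator≤1 false = z≤n

parallel : ∀ {n} (A : Arcs n) → Fin (suc n) → Fin (suc n) → Fin (length A) → Bool
parallel A u v i = ⌊ tailOf A i ≟ u ⌋ ∧ ⌊ headOf A i ≟ v ⌋

parallel-ends : ∀ {n} {A : Arcs n} {u v i} → parallel A u v i ≡ true → tailOf A i ≡ u × headOf A i ≡ v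
parallel-ends {A = A} {u} {v} {i} eq with tailOf A i ≟ u | headOf A i ≟ v
parallel-ends refl | yes tu | yes hv = tu , hv
parallel-ends ()   | yes _  | no  _
parallel-ends ()   | no  _  | _

multiplicity≡count : ∀ {n} (A : Arcs n) u v → multiplicity A u v ≡ count (parallel A u v)
multiplicity≡count A u v = sumFin-cong (length A) (λ i → if-∧ ⌊ tailOf A i ≟ u ⌋ ⌊ headOf A i ≟ v ⌋)
  where
  if-∧ : ∀ a b → (if a then (if b then 1 else 0) else 0) ≡ (if a ∧ b then 1 else 0)
  if-∧ true  b = refl
  if-∧ false b = refl

-- The cut is the set of vertices reachable from v, which misses u by acyclicity.
parallel-flow≤n : ∀ {n k} {A : Arcs n} → RootInDeg0 A → ArcMinimal n k A →
  ∀ {z} → BranchingFlow n k A z → ∀ {u v} a → parallel A u v a ≡ true → sumWhere (parallel A u v) z ≤ n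
parallel-flow≤n {n} {A = A} noArcIntoRoot minimal {z} bf a Pa with parallel-ends {A = A} Pa
... | refl , refl =
  begin
    sumWhere (parallel A u v) z                                ≤⟨ sumWhere-mono-≤ z parallel⇒entering ⟩
    flowInto A z S   ≡⟨ flowInto-closed≡count bf S S-root (reachable-closed A {v}) ⟩
    count S                ≤⟨ count-without-root≤ n S S-root ⟩
    n                                                          ∎
  where
  open ≤-Reasoning
  u = tailOf A a
  v = headOf A a
  S : Fin (suc n) → Bool
  S = reachable A v
  S-root : S root ≡ false
  S-root with S root in Sr
  ... | false = refl
  ... | true with trivial-or-enters-end A (reachable-sound A Sr)
  ...   | inj₁ v≡r        = ⊥-elim (noArcIntoRoot a v≡r)
  ...   | inj₂ (i , hi≡r) = ⊥-elim (noArcIntoRoot i hi≡r)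
  S-u : S u ≡ false
  S-u with S u in Su
  ... | false = refl
  ... | true  = ⊥-elim (ArcMinimal⇒acyclic minimal a (reachable-sound A Su))
  parallel⇒entering : ∀ i → parallel A u v i ≡ true → S (headOf A i) ∧ not (S (tailOf A i)) ≡ true
  parallel⇒entering i p with parallel-ends {A = A} p
  ... | tu , hv rewrite hv | tu | reachable-complete A {v} nil | S-u = refl

fill : ∀ {m} → ℕ → (Fin m → Bool) → ℕ → Fin m → ℕ
fill {suc m} C P R F.zero    = if P F.zero then R ⊓ C else 0
fill {suc m} C P R (F.suc i) = fill C (P ∘ F.suc) (R ∸ fill C P R F.zero) i

fill-≤ : ∀ {m} C (P : Fin m → Bool) R i → fill C P R i ≤ C
fill-≤ C P R F.zero with P F.zero
... | true  = m⊓n≤n R C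
... | false = z≤n
fill-≤ C P R (F.suc i) = fill-≤ C (P ∘ F.suc) _ i

∸⊓+≡⊔ : ∀ m n → m ∸ (m ⊓ n) + n ≡ m ⊔ n
∸⊓+≡⊔ m n with ≤-total m n
... | inj₁ m≤n rewrite m≤n⇒m⊓n≡m m≤n | n∸n≡0 m = sym (m≤n⇒m⊔n≡n m≤n)
... | inj₂ n≤m rewrite m≥n⇒m⊓n≡n n≤m = trans (m∸n+n≡m n≤m) (sym (m≥n⇒m⊔n≡m n≤m))

remainder-fits : ∀ R C c → R ≤ C + c → R ∸ (R ⊓ C) ≤ c
remainder-fits R C c R≤C+c = +-cancelʳ-≤ C _ c (begin
  R ∸ (R ⊓ C) + C   ≡⟨ ∸⊓+≡⊔ R C ⟩
  R ⊔ C             ≤⟨ ⊔-lub R≤C+c (m≤m+n C c) ⟩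
  C + c             ≡⟨ +-comm C c ⟩
  c + C             ∎)
  where open ≤-Reasoning

sumWhere-fill : ∀ {m} C (P : Fin m → Bool) R → R ≤ count P * C → sumWhere P (fill C P R) ≡ R
sumWhere-fill {zero}  C P R R≤0 = sym (n≤0⇒n≡0 R≤0)
sumWhere-fill {suc m} C P R R≤ with P F.zero
... | false = sumWhere-fill C (P ∘ F.suc) R R≤
... | true  = trans (cong (R ⊓ C +_) (sumWhere-fill C (P ∘ F.suc) (R ∸ R ⊓ C) (remainder-fits R C _ R≤)))
                    (m+[n∸m]≡n (m⊓n≤m R C))

remainder+C≤ : ∀ r C c → suc r + C ≤ C + c * C → suc r ∸ (suc r ⊓ C) + C ≤ c * C
remainder+C≤ r C c R+C≤ = begin
  suc r ∸ (suc r ⊓ C) + C   ≡⟨ ∸⊓+≡⊔ (suc r) C ⟩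
  suc r ⊔ C                 ≤⟨ ⊔-lub R≤cC (C≤cC c R≤cC) ⟩
  c * C                     ∎
  where
  open ≤-Reasoning
  R≤cC : suc r ≤ c * C
  R≤cC = +-cancelʳ-≤ C _ _ (subst (suc r + C ≤_) (+-comm C (c * C)) R+C≤)
  C≤cC : ∀ c → suc r ≤ c * C → C ≤ c * C
  C≤cC (suc c) _ = m≤m+n C (c * C)

fill-zero-suc : ∀ {m} C (P : Fin (suc m) → Bool) R {R′} → R ∸ fill C P R F.zero ≡ R′ →
  ∃ (λ i → P (F.suc i) ≡ true × fill C (P ∘ F.suc) R′ i ≡ 0) → ∃ λ i → P i ≡ true × fill C P R i ≡ 0
fill-zero-suc C P R refl (i , Pi , fi≡0) = F.suc i , Pi , fi≡0

fill-zero : ∀ {m} C (P : Fin m → Bool) R → 1 ≤ C → R + C ≤ count P * C →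
  ∃ λ i → P i ≡ true × fill C P R i ≡ 0
fill-zero {zero}  C P R 1≤C R+C≤0 = ⊥-elim (1+n≰n (≤-trans 1≤C (≤-trans (m≤n+m C R) R+C≤0)))
fill-zero {suc m} C P R 1≤C R+C≤ with P F.zero in P₀
... | false = fill-zero-suc C P R (cong (λ b → R ∸ (if b then R ⊓ C else 0)) P₀)
                (fill-zero C (P ∘ F.suc) R 1≤C R+C≤)
... | true with R
...   | zero  = F.zero , P₀ , cong (λ b → if b then 0 else 0) P₀
...   | suc r = fill-zero-suc C P (suc r) (cong (λ b → suc r ∸ (if b then suc r ⊓ C else 0)) P₀)
                (fill-zero C (P ∘ F.suc) (suc r ∸ suc r ⊓ C) 1≤C (remainder+C≤ r C (count (P ∘ F.suc)) R+C≤))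

redistribute-parallel : ∀ {n k} {A : Arcs n} {z} → BranchingFlow n k A z → ∀ u v →
  let C = suc n ∸ k; P = parallel A u v in
  1 ≤ C → sumWhere P z + C ≤ count P * C → ∃ λ z′ → BranchingFlow n k A z′ × ∃ λ i → z′ i ≡ 0
redistribute-parallel {n} {k} {A} {z} bf u v 1≤C fits =
  z′ , BranchingFlow-resp-flows cap′ out≡ in≡ bf , i , z′i≡0
  where
  C = suc n ∸ k
  P = parallel A u v
  g = fill C P (sumWhere P z)
  z′ : Fin (length A) → ℕ
  z′ j = if P j then g j else z j
  zero-slot = fill-zero C P (sumWhere P z) 1≤C fits
  i = proj₁ zero-slot
  z′i≡0 : z′ i ≡ 0
  z′i≡0 rewrite proj₁ (proj₂ zero-slot) = proj₂ (proj₂ zero-slot)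
  cap′ : ∀ j → z′ j ≤ C
  cap′ j with P j
  ... | true  = fill-≤ C P _ j
  ... | false = BranchingFlow.cap bf j
  off : ∀ j → P j ≡ false → z′ j ≡ z j
  off j Pj rewrite Pj = refl
  on : sumWhere P z′ ≡ sumWhere P z
  on = trans (sumFin-cong _ pointwise) (sumWhere-fill C P _ (≤-trans (m≤m+n _ C) fits))
    where
    pointwise : ∀ j → (if P j then z′ j else 0) ≡ (if P j then g j else 0)
    pointwise j with P j
    ... | true  = refl
    ... | false = refl
  out≡ : ∀ q → outFlow A z′ q ≡ outFlow A z q
  out≡ = sumWhere-endpoint-redistribute (tailOf A) u P (λ j Pj → proj₁ (parallel-ends {A = A} Pj)) z′ z off on
  in≡ : ∀ q → inFlow A z′ q ≡ inFlow A z q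
  in≡ = sumWhere-endpoint-redistribute (headOf A) v P (λ j Pj → proj₂ (parallel-ends {A = A} Pj)) z′ z off on

capacity-bounds : ∀ {k n} → 1 ≤ k → 2 * k ∸ 1 ≤ n → 1 ≤ suc n ∸ k × n ≤ 2 * (suc n ∸ k)
capacity-bounds {suc k} {n} _ 2k+1≤n = ≤-trans (s≤s z≤n) k+1≤d , n≤2d
  where
  k+k+1≤n : k + suc k ≤ n
  k+k+1≤n = subst (λ x → k + x ≤ n) (+-identityʳ (suc k)) 2k+1≤n
  d = n ∸ k
  k+d≡n : k + d ≡ n
  k+d≡n = m+[n∸m]≡n (≤-trans (m≤m+n k (suc k)) k+k+1≤n)
  k+1≤d : suc k ≤ d
  k+1≤d = +-cancelˡ-≤ k _ _ (subst (k + suc k ≤_) (sym k+d≡n) k+k+1≤n)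
  n≤2d : n ≤ 2 * d
  n≤2d = begin
    n            ≡⟨ sym k+d≡n ⟩
    k + d        ≤⟨ +-monoˡ-≤ d (≤-trans (n≤1+n k) k+1≤d) ⟩
    d + d        ≡⟨ cong (d +_) (sym (+-identityʳ d)) ⟩
    2 * d        ∎
    where open ≤-Reasoning

lemma8 : (k n : ℕ) → 1 ≤ k → (A : Arcs n) → RootedDigraph n A →
    ArcMinimal n k A → 2 * k ∸ 1 ≤ n → TripleFree A
lemma8 k n 1≤k A (_ , noArcIntoRoot) minimal 2k∸1≤n u v with multiplicity A u v ≤? 2
... | yes ≤2 = ≤2
... | no  ≰2 with redistribute-parallel bf u v 1≤C fits
  where
  C = suc n ∸ k
  1≤C = proj₁ (capacity-bounds 1≤k 2k∸1≤n)
  n≤2C = proj₂ (capacity-bounds 1≤k 2k∸1≤n)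
  z = proj₁ (proj₁ minimal)
  bf = proj₂ (proj₁ minimal)
  P = parallel A u v
  3≤count : 3 ≤ count P
  3≤count = subst (3 ≤_) (multiplicity≡count A u v) (≰⇒> ≰2)
  a = count-positive P (≤-trans (s≤s z≤n) 3≤count)
  flow≤n = parallel-flow≤n noArcIntoRoot minimal bf (proj₁ a) (proj₂ a)
  fits : sumWhere P z + C ≤ count P * C
  fits = begin
    sumWhere P z + C   ≤⟨ +-monoˡ-≤ C (≤-trans flow≤n n≤2C) ⟩
    2 * C + C          ≡⟨ +-comm (2 * C) C ⟩
    3 * C              ≤⟨ *-monoˡ-≤ C 3≤count ⟩
    count P * C        ∎
    where open ≤-Reasoning
... | z′ , bf′ , i , z′i≡0 = ⊥-elim (1+n≰n (subst (1 ≤_) z′i≡0 (ArcMinimal⇒positive minimal bf′ i)))
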